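{- Let $\mathbf{L}$ be a dually ms Stone semi-Heyting algebra and $x\in L$. Then $(x^{**})' = ((x^*)')^*$. Consequently $(x^*)^+ \le x^{**}$, where $y^+ := (((y)')^*)'$.
   Context: A semi-Heyting algebra is an algebra $\langle L,\vee,\wedge,\to,0,1\rangle$ such that $\langle L,\vee,\wedge,0,1\rangle$ is a bounded lattice and the identities $x\wedge(x\to y)\approx x\wedge y$, $x\wedge(y\to z)\approx x\wedge[(x\wedge y)\to(x\wedge z)]$, and $x\to x\approx 1$ hold; $x^* := x\to 0$ is the pseudocomplement. A dually quasi-De Morgan semi-Heyting algebra is an algebra $\langle L,\vee,\wedge,\to,{}',0,1\rangle$ whose reduct $\langle L,\vee,\wedge,\to,0,1\rangle$ is a semi-Heyting algebra and which satisfies $0'\approx 1$, $1'\approx 0$, $(x\wedge y)'\approx x'\vee y'$, $(x\vee y)''\approx x''\vee y''$, and $x''\le x$. A dually ms Stone semi-Heyting algebra is a dually quasi-De Morgan semi-Heyting algebra that additionally satisfies $(x\vee y)'\approx x'\wedge y'$ and the Stone identity $x^*\vee x^{**}\approx 1$. -}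

module Defs where

open import Level using (Level; suc; _⊔_)
open import Relation.Binary.PropositionalEquality using (_≡_)

record DmsStoneSH (c : Level) : Set (suc c) where
  infixr 6 _∨_
  infixr 7 _∧_
  infixr 5 _⇒_
  field
    Carrier : Set c
    _∨_ _∧_ _⇒_ : Carrier → Carrier → Carrier
    ′_ : Carrier → Carrier
    𝟘 𝟙 : Carrier
    ∨-comm  : ∀ x y → x ∨ y ≡ y ∨ x
    ∧-comm  : ∀ x y → x ∧ y ≡ y ∧ x
    ∨-assoc : ∀ x y z → (x ∨ y) ∨ z ≡ x ∨ (y ∨ z)
    ∧-assoc : ∀ x y z → (x ∧ y) ∧ z ≡ x ∧ (y ∧ z)
    ∨-absorbs-∧ : ∀ x y → x ∨ (x ∧ y) ≡ x
    ∧-absorbs-∨ : ∀ x y → x ∧ (x ∨ y) ≡ x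
    ∨-identity : ∀ x → x ∨ 𝟘 ≡ x
    ∧-identity : ∀ x → x ∧ 𝟙 ≡ x
    sh1 : ∀ x y → x ∧ (x ⇒ y) ≡ x ∧ y
    sh2 : ∀ x y z → x ∧ (y ⇒ z) ≡ x ∧ ((x ∧ y) ⇒ (x ∧ z))
    sh3 : ∀ x → x ⇒ x ≡ 𝟙
    dq1 : ′ 𝟘 ≡ 𝟙
    dq2 : ′ 𝟙 ≡ 𝟘
    dq3 : ∀ x y → ′ (x ∧ y) ≡ (′ x) ∨ (′ y)
    dq4 : ∀ x y → ′ ′ (x ∨ y) ≡ (′ ′ x) ∨ (′ ′ y)
    dq5 : ∀ x → (′ ′ x) ∧ x ≡ ′ ′ x
    dms : ∀ x y → ′ (x ∨ y) ≡ (′ x) ∧ (′ y)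
    stone : ∀ x → ((x ⇒ 𝟘)) ∨ ((x ⇒ 𝟘) ⇒ 𝟘) ≡ 𝟙

  _≤_ : Carrier → Carrier → Set c
  x ≤ y = x ∧ y ≡ x

  _* : Carrier → Carrier
  x * = x ⇒ 𝟘

  _⁺ : Carrier → Carrier
  y ⁺ = ′ ((′ y) *)

module Submission where

-- In a semi-Heyting algebra the pseudocomplement u* is the
-- largest element disjoint from u, and it is also the only possible
-- complement of u: if u ∧ v = 0 and u ∨ v = 1 then v = u*.  For the
-- first claim we apply this to u = (x*)′ and v = (x**)′.  The dual
-- De Morgan laws turn the two required equations into
--   ((x*) ∨ (x**))′ = 1′ = 0     (Stone identity),
--   ((x*) ∧ (x**))′ = 0′ = 1     (x* is disjoint from x**),
-- so (x**)′ = ((x*)′)*.  The second claim follows by rewriting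
-- (x*)⁺ = (((x*)′)*)′ as (x**)′′ and using y′′ ≤ y.

open import Defs
open import Level using (Level)
open import Data.Product using (_×_; _,_)
open import Relation.Binary.PropositionalEquality
  using (_≡_; sym; subst; trans; cong; module ≡-Reasoning)

module Properties {c : Level} (L : DmsStoneSH c) where
  open DmsStoneSH L
  open ≡-Reasoning

  ∧-idem : ∀ x → x ∧ x ≡ x
  ∧-idem x = trans (cong (x ∧_) (sym (∨-absorbs-∧ x x))) (∧-absorbs-∨ x (x ∧ x))

  ∧-zeroʳ : ∀ x → x ∧ 𝟘 ≡ 𝟘
  ∧-zeroʳ x = begin
    x ∧ 𝟘         ≡⟨ ∧-comm x 𝟘 ⟩
    𝟘 ∧ x         ≡⟨ cong (𝟘 ∧_) (sym (trans (∨-comm 𝟘 x) (∨-identity x))) ⟩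
    𝟘 ∧ (𝟘 ∨ x)   ≡⟨ ∧-absorbs-∨ 𝟘 x ⟩
    𝟘             ∎

  ≤-antisym : ∀ {x y} → x ≤ y → y ≤ x → x ≡ y
  ≤-antisym {x} {y} x≤y y≤x = trans (sym x≤y) (trans (∧-comm x y) y≤x)

  ≤⇒∨ : ∀ {x y} → x ≤ y → x ∨ y ≡ y
  ≤⇒∨ {x} {y} x≤y = begin
    x ∨ y         ≡⟨ cong (_∨ y) (sym x≤y) ⟩
    (x ∧ y) ∨ y   ≡⟨ ∨-comm (x ∧ y) y ⟩
    y ∨ (x ∧ y)   ≡⟨ cong (y ∨_) (∧-comm x y) ⟩
    y ∨ (y ∧ x)   ≡⟨ ∨-absorbs-∧ y x ⟩
    y             ∎

  ∨⇒≤ : ∀ {x y} → x ∨ y ≡ y → x ≤ y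
  ∨⇒≤ {x} {y} e = trans (cong (x ∧_) (sym e)) (∧-absorbs-∨ x y)

  ∨-least : ∀ {x y h} → x ≤ h → y ≤ h → (x ∨ y) ≤ h
  ∨-least {x} {y} {h} x≤h y≤h = ∨⇒≤ (begin
    (x ∨ y) ∨ h   ≡⟨ ∨-assoc x y h ⟩
    x ∨ (y ∨ h)   ≡⟨ cong (x ∨_) (≤⇒∨ y≤h) ⟩
    x ∨ h         ≡⟨ ≤⇒∨ x≤h ⟩
    h             ∎)

  𝟙≤⇒≡𝟙 : ∀ {h} → 𝟙 ≤ h → h ≡ 𝟙
  𝟙≤⇒≡𝟙 {h} 𝟙≤h = ≤-antisym (∧-identity h) 𝟙≤h

  agree⇒≤⇒ : ∀ {a b c} → c ∧ a ≡ c ∧ b → c ≤ (a ⇒ b)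
  agree⇒≤⇒ {a} {b} {c} agree = begin
    c ∧ (a ⇒ b)               ≡⟨ sh2 c a b ⟩
    c ∧ ((c ∧ a) ⇒ (c ∧ b))   ≡⟨ cong (λ t → c ∧ (t ⇒ (c ∧ b))) agree ⟩
    c ∧ ((c ∧ b) ⇒ (c ∧ b))   ≡⟨ cong (c ∧_) (sh3 (c ∧ b)) ⟩
    c ∧ 𝟙                     ≡⟨ ∧-identity c ⟩
    c                         ∎

  ⇒≡𝟙⇒≤ : ∀ {a b} → a ⇒ b ≡ 𝟙 → a ≤ b
  ⇒≡𝟙⇒≤ {a} {b} e = trans (sym (sh1 a b)) (trans (cong (a ∧_) e) (∧-identity a))

  x∧x*≡𝟘 : ∀ x → x ∧ (x *) ≡ 𝟘
  x∧x*≡𝟘 x = trans (sh1 x 𝟘) (∧-zeroʳ x)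

  disjoint⇒≤* : ∀ {u v} → u ∧ v ≡ 𝟘 → v ≤ (u *)
  disjoint⇒≤* {u} {v} u∧v≡𝟘 =
    agree⇒≤⇒ (trans (∧-comm v u) (trans u∧v≡𝟘 (sym (∧-zeroʳ v))))

  -- A complement of u, if one exists, is its pseudocomplement.  Both u and
  -- v lie below u* ⇒ v, hence so does u ∨ v = 𝟙; modus ponens gives u* ≤ v.
  complement≡* : ∀ {u v} → u ∧ v ≡ 𝟘 → u ∨ v ≡ 𝟙 → v ≡ u *
  complement≡* {u} {v} u∧v≡𝟘 u∨v≡𝟙 = ≤-antisym v≤u* u*≤v
    where
    v≤u* : v ≤ (u *)
    v≤u* = disjoint⇒≤* u∧v≡𝟘

    u≤u*⇒v : u ≤ ((u *) ⇒ v)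
    u≤u*⇒v = agree⇒≤⇒ (trans (x∧x*≡𝟘 u) (sym u∧v≡𝟘))

    v≤u*⇒v : v ≤ ((u *) ⇒ v)
    v≤u*⇒v = agree⇒≤⇒ (trans v≤u* (sym (∧-idem v)))

    u*≤v : (u *) ≤ v
    u*≤v = ⇒≡𝟙⇒≤ (𝟙≤⇒≡𝟙 (subst (_≤ ((u *) ⇒ v)) u∨v≡𝟙 (∨-least u≤u*⇒v v≤u*⇒v)))

  -- The dually ms Stone part: (x**)′ is the complement of (x*)′.
  ′**≡′** : ∀ x → ′ ((x *) *) ≡ (′ (x *)) *
  ′**≡′** x = complement≡* disjoint covering
    where
    disjoint : (′ (x *)) ∧ (′ ((x *) *)) ≡ 𝟘
    disjoint = trans (sym (dms (x *) ((x *) *))) (trans (cong ′_ (stone x)) dq2)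

    covering : (′ (x *)) ∨ (′ ((x *) *)) ≡ 𝟙
    covering = trans (sym (dq3 (x *) ((x *) *))) (trans (cong ′_ (x∧x*≡𝟘 (x *))) dq1)

  -- Hence (x*)⁺ = (x**)′′, which lies below x** since y′′ ≤ y.
  *⁺≤** : ∀ x → ((x *) ⁺) ≤ ((x *) *)
  *⁺≤** x rewrite sym (′**≡′** x) = dq5 ((x *) *)

lemma4p4 : {c : Level} (L : DmsStoneSH c) → let open DmsStoneSH L in
    ∀ x → (′ ((x *) *) ≡ (′ (x *)) *) × (((x *) ⁺) ≤ ((x *) *))
lemma4p4 L x = ′**≡′** x , *⁺≤** x
  where open Properties L
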